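{- Let $G=(S,C,H)$ be a thick spider graph of weight $r\ge 3$, with $S=\{s_1,\ldots,s_r\}$ and $C=\{c_1,\ldots,c_r\}$, and let $Z$ be a Grundy total dominating sequence of $G[H]$. Then: 1. $(s_1,s_2)\oplus Z\oplus(c_1,c_2)$ is a Grundy total dominating sequence of $G$ and of $(S,C\hookleftarrow K_2,H)$, and $\gamma_{\rm gr}^t(G)=\gamma_{\rm gr}^t(S,C\hookleftarrow K_2,H)=4+\gamma_{\rm gr}^t(G[H])$. 2. $(s_1,s_2,s_r,s'_r)\oplus Z\oplus(c_1,c_2)$ is a Grundy total dominating sequence of $(S\hookleftarrow K_2,C,H)$, and $\gamma_{\rm gr}^t(S\hookleftarrow K_2,C,H)=\gamma_{\rm gr}^t(G)+2=6+\gamma_{\rm gr}^t(G[H])$.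
   Context: All graphs are finite and simple; $N(x)$ is the open neighborhood of $x$. A sequence $(v_1,\ldots,v_k)$ of distinct vertices is legal if for every $i\in\{1,\ldots,k\}$, $N(v_i)\setminus\bigcup_{j=1}^{i-1}N(v_j)\neq\emptyset$ (the empty sequence is legal). $\gamma_{\rm gr}^t(G)$ is the maximum length of a legal sequence (defined also for graphs with isolated vertices, and $0$ for graphs without edges, including the graph with no vertices), and a legal sequence of that length is a Grundy total dominating sequence. A thick spider graph $(S,C,H)$ of weight $r$ is a graph whose vertex set is partitioned into $S=\{s_1,\ldots,s_r\}$, $C=\{c_1,\ldots,c_r\}$ and a possibly empty set $H$, where $S$ is a stable set, $C$ is a clique, every vertex of $H$ is adjacent to every vertex of $C$, no vertex of $H$ is adjacent to a vertex of $S$, and $s_i$ is adjacent to $c_j$ if and only if $i\neq j$. $(S,C\hookleftarrow K_2,H)$ is the graph obtained from $(S,C,H)$ by adding a new vertex $c'_r$ adjacent to $c_r$ and to every neighbor of $c_r$; $(S\hookleftarrow K_2,C,H)$ is obtained by adding a new vertex $s'_r$ adjacent to $s_r$ and to every neighbor of $s_r$. $G[H]$ is the subgraph induced by $H$. For sequences with disjoint vertex sets, $(a_1,\ldots,a_n)\oplus(b_1,\ldots,b_m)=(a_1,\ldots,a_n,b_1,\ldots,b_m)$. -}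

module Defs where

open import Data.Nat using (ℕ; zero; suc; _+_; _≤_; _<_)
open import Data.Fin using (Fin; toℕ; fromℕ)
open import Data.List using (List; []; _∷_; _++_; length; lookup; map)
open import Data.List.Relation.Unary.Unique.Propositional using (Unique)
open import Data.Maybe using (Maybe; just; nothing)
open import Data.Product using (Σ; _×_; _,_; ∃)
open import Data.Sum using (_⊎_; inj₁; inj₂)
open import Data.Empty using (⊥)
open import Data.Unit using (⊤; tt)
open import Relation.Nullary using (¬_)
open import Relation.Binary.PropositionalEquality using (_≡_; _≢_; refl; sym)

record Graph (V : Set) : Set₁ where
  field
    Adj    : V → V → Set
    adj-sym    : ∀ {x y} → Adj x y → Adj y x
    adj-irrefl : ∀ {x} → ¬ Adj x x
open Graph public

Legal : ∀ {V} → Graph V → List V → Set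
Legal G vs =
  Unique vs ×
  ((i : Fin (length vs)) →
     ∃ λ u → Adj G (lookup vs i) u ×
       ((j : Fin (length vs)) → toℕ j < toℕ i → ¬ Adj G (lookup vs j) u))

IsGrundyTDS : ∀ {V} → Graph V → List V → Set
IsGrundyTDS G vs = Legal G vs × (∀ ws → Legal G ws → length ws ≤ length vs)

GrundyTotalDomNum : ∀ {V} → Graph V → ℕ → Set
GrundyTotalDomNum G k = Σ _ λ vs → IsGrundyTDS G vs × length vs ≡ k

data Vtx (r h : ℕ) : Set where
  s  : Fin r → Vtx r h
  c  : Fin r → Vtx r h
  hv : Fin h → Vtx r h

module _ {r h : ℕ} (HG : Graph (Fin h)) where

  SpAdj : Vtx r h → Vtx r h → Set
  SpAdj (s i)  (s j)  = ⊥
  SpAdj (s i)  (c j)  = i ≢ j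
  SpAdj (s i)  (hv y) = ⊥
  SpAdj (c i)  (s j)  = i ≢ j
  SpAdj (c i)  (c j)  = i ≢ j
  SpAdj (c i)  (hv y) = ⊤
  SpAdj (hv x) (s j)  = ⊥
  SpAdj (hv x) (c j)  = ⊤
  SpAdj (hv x) (hv y) = Adj HG x y

  SpSym : ∀ {x y} → SpAdj x y → SpAdj y x
  SpSym {s i}  {s j}  ()
  SpSym {s i}  {c j}  p = λ e → p (sym e)
  SpSym {s i}  {hv y} ()
  SpSym {c i}  {s j}  p = λ e → p (sym e)
  SpSym {c i}  {c j}  p = λ e → p (sym e)
  SpSym {c i}  {hv y} p = tt
  SpSym {hv x} {s j}  ()
  SpSym {hv x} {c j}  p = tt
  SpSym {hv x} {hv y} p = adj-sym HG p

  SpIrr : ∀ {x} → ¬ SpAdj x x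
  SpIrr {s i}  ()
  SpIrr {c i}  p = p refl
  SpIrr {hv x} p = adj-irrefl HG p

-- the thick spider graph (S,C,H); vertex s i is s_{i+1}, c i is c_{i+1}
ThickSpider : (r : ℕ) {h : ℕ} → Graph (Fin h) → Graph (Vtx r h)
ThickSpider r HG = record { Adj = SpAdj HG ; adj-sym = λ {x} {y} → SpSym HG {x} {y} ; adj-irrefl = λ {x} → SpIrr HG {x} }

module _ {V : Set} (G : Graph V) (t : V) where

  TwAdj : Maybe V → Maybe V → Set
  TwAdj (just x) (just y) = Adj G x y
  TwAdj (just x) nothing  = x ≡ t ⊎ Adj G t x
  TwAdj nothing  (just y) = y ≡ t ⊎ Adj G t y
  TwAdj nothing  nothing  = ⊥

  TwSym : ∀ {x y} → TwAdj x y → TwAdj y x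
  TwSym {just x} {just y} p = adj-sym G p
  TwSym {just x} {nothing} p = p
  TwSym {nothing} {just y} p = p
  TwSym {nothing} {nothing} ()

  TwIrr : ∀ {x} → ¬ TwAdj x x
  TwIrr {just x} p = adj-irrefl G p
  TwIrr {nothing} ()

AddTwin : ∀ {V} → Graph V → V → Graph (Maybe V)
AddTwin G t = record { Adj = TwAdj G t ; adj-sym = λ {x} {y} → TwSym G t {x} {y} ; adj-irrefl = λ {x} → TwIrr G t {x} }

-- (S, C ↩ K2, H) and (S ↩ K2, C, H) for weight r = suc m (the new vertex
-- c'_r resp. s'_r is `nothing`, old vertices v are `just v`)
SpiderCK2 : (m : ℕ) {h : ℕ} → Graph (Fin h) → Graph (Maybe (Vtx (suc m) h))
SpiderCK2 m HG = AddTwin (ThickSpider (suc m) HG) (c (fromℕ m))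

SpiderSK2 : (m : ℕ) {h : ℕ} → Graph (Fin h) → Graph (Maybe (Vtx (suc m) h))
SpiderSK2 m HG = AddTwin (ThickSpider (suc m) HG) (s (fromℕ m))

-- The footprint of a step of a legal sequence of these graphs is either an edge of G[H] (those
-- steps form a legal sequence of G[H]) or lies in one of a few regions: C, S ∪ H (reached only
-- from C and c′_r), and singletons such as {s′_r}. Every vertex sees all of such a region but at
-- most one vertex, so a region receives at most two footprints and a singleton at most one. This
-- bounds the length by 6 + γ(G[H]) for (S↩K₂,C,H). In (S,C↩K₂,H) the vertex s_r misses both twins
-- c_r, c′_r; a look at the first two vertices of the sequence gives the bound 4 + γ(G[H]), which
-- passes to its induced subgraph (S,C,H). The sequences of the statement attain the bounds.
module Submission where

open import Defs
open import Data.Nat using (ℕ; zero; suc; _+_; _≤_; _<_; s≤s; z≤n)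
open import Data.Nat.Properties
  using (≤-refl; ≤-trans; ≤-reflexive; ≤-antisym; +-suc; +-comm; +-monoˡ-≤; +-monoʳ-≤; +-monoˡ-<; +-monoʳ-<)
open import Data.Fin using (Fin; zero; suc; toℕ; fromℕ; _≟_)
open import Data.List using (List; []; _∷_; _++_; length; map; lookup)
open import Data.List.Properties using (length-map; length-++)
open import Data.List.Relation.Unary.All using (All; []; _∷_)
import Data.List.Relation.Unary.All as All
import Data.List.Relation.Unary.All.Properties as All
open import Data.List.Relation.Unary.Any using (Any; here; there)
open import Data.List.Relation.Unary.AllPairs using ([]; _∷_)
open import Data.List.Relation.Unary.Unique.Propositional using (Unique)
open import Data.Maybe using (Maybe; just; nothing)
open import Data.Product using (∃; ∃₂; _×_; _,_; proj₁; map₂)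
open import Data.Sum using (_⊎_; inj₁; inj₂; [_,_])
open import Data.Empty using (⊥; ⊥-elim)
open import Data.Unit using (⊤; tt)
open import Function using (_∘_)
open import Level using (0ℓ)
open import Relation.Nullary using (¬_; yes; no)
open import Relation.Nullary.Decidable using (decidable-stable)
open import Relation.Unary using (Pred; ∅; ｛_｝; _∪_; _⊆_; _∉_)
open import Relation.Binary.PropositionalEquality
  using (_≡_; _≢_; refl; sym; trans; subst; cong; module ≡-Reasoning)

module _ {V : Set} (G : Graph V) where

  Footprint : Pred V 0ℓ → V → Set
  Footprint D x = ∃ λ u → Adj G x u × u ∉ D

  LegalFrom : Pred V 0ℓ → List V → Set
  LegalFrom D []       = ⊤
  LegalFrom D (x ∷ xs) = Footprint D x × LegalFrom (D ∪ Adj G x) xs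

  _∪N*_ : Pred V 0ℓ → List V → Pred V 0ℓ
  D ∪N* []       = D
  D ∪N* (x ∷ xs) = (D ∪ Adj G x) ∪N* xs

  LegalFrom-antimono : ∀ {D D′} → D ⊆ D′ → ∀ xs → LegalFrom D′ xs → LegalFrom D xs
  LegalFrom-antimono D⊆D′ []       _ = tt
  LegalFrom-antimono D⊆D′ (x ∷ xs) ((u , xu , u∉D′) , rest) =
    (u , xu , u∉D′ ∘ D⊆D′) , LegalFrom-antimono [ inj₁ ∘ D⊆D′ , inj₂ ] xs rest

  LegalFrom-++ : ∀ {D} xs {ys} → LegalFrom D xs → LegalFrom (D ∪N* xs) ys → LegalFrom D (xs ++ ys)
  LegalFrom-++ []       _           legal-ys = legal-ys
  LegalFrom-++ (x ∷ xs) (fp , rest) legal-ys = fp , LegalFrom-++ xs rest legal-ys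

  ∉-∪N* : ∀ {D v} xs → All (λ x → ¬ Adj G x v) xs → v ∉ D → v ∉ D ∪N* xs
  ∉-∪N* []       []              v∉D = v∉D
  ∉-∪N* (x ∷ xs) (¬xv ∷ ¬xs-v) v∉D = ∉-∪N* xs ¬xs-v [ v∉D , ¬xv ]

  private
    Indexed : Pred V 0ℓ → List V → Set
    Indexed D vs = (i : Fin (length vs)) → ∃ λ u → Adj G (lookup vs i) u × u ∉ D ×
                     ((j : Fin (length vs)) → toℕ j < toℕ i → ¬ Adj G (lookup vs j) u)

    indexed⇒LegalFrom : ∀ {D} vs → Indexed D vs → LegalFrom D vs
    indexed⇒LegalFrom []       _       = tt
    indexed⇒LegalFrom {D} (x ∷ xs) indexed = first , indexed⇒LegalFrom xs shifted
      where
      first : Footprint D x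
      first = let u , xu , u∉D , _ = indexed zero in u , xu , u∉D
      shifted : Indexed (D ∪ Adj G x) xs
      shifted i = let u , yu , u∉D , earlier = indexed (suc i) in
        u , yu , [ u∉D , earlier zero (s≤s z≤n) ] , λ j j<i → earlier (suc j) (s≤s j<i)

    LegalFrom⇒indexed : ∀ {D} vs → LegalFrom D vs → Indexed D vs
    LegalFrom⇒indexed (x ∷ xs) ((u , xu , u∉D) , _) zero = u , xu , u∉D , λ _ ()
    LegalFrom⇒indexed (x ∷ xs) (_ , rest) (suc i) with LegalFrom⇒indexed xs rest i
    ... | u , yu , u∉D∪Nx , earlier =
      u , yu , u∉D∪Nx ∘ inj₁ , λ { zero _ → u∉D∪Nx ∘ inj₂ ; (suc j) (s≤s j<i) → earlier j j<i }

  -- a vertex whose whole neighbourhood is dominated has no footprint left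
  LegalFrom-excludes : ∀ {D y} → Adj G y ⊆ D → ∀ xs → LegalFrom D xs → All (y ≢_) xs
  LegalFrom-excludes Ny⊆D []       _                      = []
  LegalFrom-excludes Ny⊆D (x ∷ xs) ((u , xu , u∉D) , rest) =
    (λ { refl → u∉D (Ny⊆D xu) }) ∷ LegalFrom-excludes (inj₁ ∘ Ny⊆D) xs rest

  LegalFrom⇒Unique : ∀ {D} xs → LegalFrom D xs → Unique xs
  LegalFrom⇒Unique []       _          = []
  LegalFrom⇒Unique (x ∷ xs) (_ , rest) = LegalFrom-excludes inj₂ xs rest ∷ LegalFrom⇒Unique xs rest

  Legal⇒LegalFrom : ∀ vs → Legal G vs → LegalFrom ∅ vs
  Legal⇒LegalFrom vs (_ , legal) =
    indexed⇒LegalFrom vs λ i → let u , xu , earlier = legal i in u , xu , (λ ()) , earlier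

  LegalFrom⇒Legal : ∀ vs → LegalFrom ∅ vs → Legal G vs
  LegalFrom⇒Legal vs legal =
    LegalFrom⇒Unique vs legal ,
    λ i → let u , xu , _ , earlier = LegalFrom⇒indexed vs legal i in u , xu , earlier

record Embedding {A V : Set} (G : Graph A) (Γ : Graph V) : Set where
  field
    embed     : A → V
    preserves : ∀ {a b} → Adj G a b → Adj Γ (embed a) (embed b)
    reflects  : ∀ {a b} → Adj Γ (embed a) (embed b) → Adj G a b

_∘ᴱ_ : ∀ {A B V} {G : Graph A} {Γ : Graph B} {Δ : Graph V} → Embedding Γ Δ → Embedding G Γ → Embedding G Δ
f ∘ᴱ g = record
  { embed     = F.embed ∘ G.embed
  ; preserves = F.preserves ∘ G.preserves
  ; reflects  = G.reflects ∘ F.reflects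
  }
  where module F = Embedding f; module G = Embedding g

module _ {A V : Set} {G : Graph A} {Γ : Graph V} (e : Embedding G Γ) where
  open Embedding e

  LegalFrom-embed : ∀ {D D′} → D′ ∘ embed ⊆ D → ∀ xs → LegalFrom G D xs → LegalFrom Γ D′ (map embed xs)
  LegalFrom-embed D′⊆D []       _                      = tt
  LegalFrom-embed D′⊆D (x ∷ xs) ((u , xu , u∉D) , rest) =
    (embed u , preserves xu , u∉D ∘ D′⊆D) , LegalFrom-embed [ inj₁ ∘ D′⊆D , inj₂ ∘ reflects ] xs rest

Legal-embed : ∀ {A V} {G : Graph A} {Γ : Graph V} (e : Embedding G Γ) {W} →
              Legal G W → Legal Γ (map (Embedding.embed e) W)
Legal-embed {G = G} {Γ} e {W} legal =
  LegalFrom⇒Legal Γ _ (LegalFrom-embed e (λ ()) W (Legal⇒LegalFrom G W legal))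

AtMostLonger : ∀ {V A} → Graph V → ℕ → Graph A → Set
AtMostLonger Γ b G = ∀ W → Legal Γ W → ∃ λ E → Legal G E × length W ≤ b + length E

AtMostLonger-fromLegalFrom : ∀ {V A} {Γ : Graph V} {G : Graph A} {b} →
                             (∀ W → LegalFrom Γ ∅ W → ∃ λ E → LegalFrom G ∅ E × length W ≤ b + length E) →
                             AtMostLonger Γ b G
AtMostLonger-fromLegalFrom {Γ = Γ} {G} bound W legal =
  let E , legalE , le = bound W (Legal⇒LegalFrom Γ W legal) in E , LegalFrom⇒Legal G E legalE , le

AtMostLonger-embed : ∀ {V W A} {Γ : Graph V} {Δ : Graph W} {G : Graph A} {b} →
                     Embedding Γ Δ → AtMostLonger Δ b G → AtMostLonger Γ b G
AtMostLonger-embed e bound W legal =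
  let E , legalE , le = bound (map embed W) (Legal-embed e legal)
  in  E , legalE , subst (_≤ _ + length E) (length-map embed W) le
  where open Embedding e

module _ {V : Set} (Γ : Graph V) where

  record AlmostDominates (x : V) (T : Pred V 0ℓ) : Set where
    constructor dominatesExcept
    field
      exception        : V
      unseen⇒exception : ∀ {t} → T t → ¬ Adj Γ x t → t ≡ exception

  almostDominates-｛｝ : ∀ x {m} → AlmostDominates x ｛ m ｝
  almostDominates-｛｝ _ {m} = dominatesExcept m λ m≡t _ → sym m≡t

-- The phase of a region T bounds the footprints T can still receive: two while
-- nothing is known, one once m is its only undominated vertex, none afterwards.
data Phase (V : Set) : Set where
  fresh  : Phase V
  allBut : V → Phase V
  done   : Phase V

cost : ∀ {V} → Phase V → ℕ
cost fresh      = 2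
cost (allBut _) = 1
cost done       = 0

data Invariant {V : Set} (T D : Pred V 0ℓ) : Phase V → Set where
  fresh  : Invariant T D fresh
  allBut : ∀ {m} → (∀ {t} → T t → t ∉ D → t ≡ m) → Invariant T D (allBut m)
  done   : (∀ {t} → T t → t ∉ D → ⊥) → Invariant T D done

Invariant-mono : ∀ {V} {T D D′ : Pred V 0ℓ} {φ} → D ⊆ D′ → Invariant T D φ → Invariant T D′ φ
Invariant-mono D⊆D′ fresh           = fresh
Invariant-mono D⊆D′ (allBut unseen) = allBut λ Tt t∉D′ → unseen Tt (t∉D′ ∘ D⊆D′)
Invariant-mono D⊆D′ (done unseen)   = done λ Tt t∉D′ → unseen Tt (t∉D′ ∘ D⊆D′)

module _ {V : Set} (Γ : Graph V) where

  after-almostDominates : ∀ {T D x} (a : AlmostDominates Γ x T) →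
                          Invariant T (D ∪ Adj Γ x) (allBut (AlmostDominates.exception a))
  after-almostDominates (dominatesExcept _ unseen⇒m) = allBut λ Tt t∉ → unseen⇒m Tt (t∉ ∘ inj₂)

  after-dominates : ∀ {T D} x → T ⊆ Adj Γ x → Invariant T (D ∪ Adj Γ x) done
  after-dominates x T⊆Nx = done λ Tt t∉ → t∉ (inj₂ (T⊆Nx Tt))

  allBut⇒done : ∀ {T D m} x → Invariant T D (allBut m) → Adj Γ x m → Invariant T (D ∪ Adj Γ x) done
  allBut⇒done x (allBut unseen) xm =
    done λ Tt t∉ → t∉ (inj₂ (subst (Adj Γ x) (sym (unseen Tt (t∉ ∘ inj₁))) xm))

  advance : ∀ {T D x u φ} → Invariant T D φ → T u → AlmostDominates Γ x T → Adj Γ x u → u ∉ D →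
            ∃ λ φ′ → Invariant T (D ∪ Adj Γ x) φ′ × cost φ′ < cost φ
  advance fresh           _  almost _  _   = _ , after-almostDominates almost , ≤-refl
  advance (allBut unseen) Tu _      xu u∉D =
    done , allBut⇒done _ (allBut unseen) (subst (Adj Γ _) (unseen Tu u∉D) xu) , ≤-refl
  advance (done unseen)   Tu _      _  u∉D = ⊥-elim (unseen Tu u∉D)

module Regions {A V : Set} {G : Graph A} {Γ : Graph V} (e : Embedding G Γ) where
  open Embedding e

  Phases : List (Pred V 0ℓ) → Set₁
  Phases = All (λ _ → Phase V)

  totalCost : ∀ {Ts} → Phases Ts → ℕ
  totalCost []       = 0
  totalCost (φ ∷ φs) = cost φ + totalCost φs

  Invariants : ∀ {Ts} → Phases Ts → Pred V 0ℓ → Set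
  Invariants {[]}     []       D = ⊤
  Invariants {T ∷ Ts} (φ ∷ φs) D = Invariant T D φ × Invariants φs D

  Invariants-mono : ∀ {Ts D D′} → D ⊆ D′ → (φs : Phases Ts) → Invariants φs D → Invariants φs D′
  Invariants-mono D⊆D′ []       _            = tt
  Invariants-mono D⊆D′ (φ ∷ φs) (inv , invs) = Invariant-mono D⊆D′ inv , Invariants-mono D⊆D′ φs invs

  InnerStep : V → V → Set
  InnerStep x u = ∃₂ λ a b → x ≡ embed a × u ≡ embed b

  Classifies : List (Pred V 0ℓ) → Set₁
  Classifies Ts = ∀ {x u} → Adj Γ x u → InnerStep x u ⊎ Any (λ T → T u × AlmostDominates Γ x T) Ts

  advanceAll : ∀ {Ts D x u} (φs : Phases Ts) → Invariants φs D →
               Any (λ T → T u × AlmostDominates Γ x T) Ts → Adj Γ x u → u ∉ D →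
               ∃ λ (φs′ : Phases Ts) → Invariants φs′ (D ∪ Adj Γ x) × totalCost φs′ < totalCost φs
  advanceAll (φ ∷ φs) (inv , invs) (here (Tu , almost)) xu u∉D =
    let φ′ , inv′ , φ′<φ = advance Γ inv Tu almost xu u∉D
    in  φ′ ∷ φs , (inv′ , Invariants-mono inj₁ φs invs) , +-monoˡ-< (totalCost φs) φ′<φ
  advanceAll (φ ∷ φs) (inv , invs) (there hit) xu u∉D =
    let φs′ , invs′ , φs′<φs = advanceAll φs invs hit xu u∉D
    in  φ ∷ φs′ , (Invariant-mono inj₁ inv , invs′) , +-monoʳ-< (cost φ) φs′<φs

  -- inner steps extend E, every other step lowers the total cost
  run : ∀ {Ts} → Classifies Ts → ∀ {D} (φs : Phases Ts) → Invariants φs D → ∀ W → LegalFrom Γ D W →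
        ∃ λ E → LegalFrom G (D ∘ embed) E × length W ≤ totalCost φs + length E
  run classify φs invs []      _                       = [] , tt , z≤n
  run classify φs invs (x ∷ W) ((u , xu , u∉D) , rest) with classify xu
  ... | inj₁ (a , b , refl , refl) =
    let E , legal , bound = run classify φs (Invariants-mono inj₁ φs invs) W rest
    in  a ∷ E , ((b , reflects xu , u∉D) , LegalFrom-antimono G [ inj₁ , inj₂ ∘ preserves ] E legal) ,
        ≤-trans (s≤s bound) (≤-reflexive (sym (+-suc (totalCost φs) (length E))))
  ... | inj₂ hit =
    let φs′ , invs′ , φs′<φs = advanceAll φs invs hit xu u∉D
        E , legal , bound   = run classify φs′ invs′ W rest
    in  E , LegalFrom-antimono G inj₁ E legal , ≤-trans (s≤s bound) (+-monoˡ-≤ (length E) φs′<φs)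

  Budget : List (Pred V 0ℓ) → Pred V 0ℓ → ℕ → Set₁
  Budget Ts D k = ∃ λ (φs : Phases Ts) → Invariants φs D × totalCost φs ≡ k

  LegalFrom-length : ∀ {Ts D k} → Classifies Ts → Budget Ts D k → ∀ W → LegalFrom Γ D W →
                     ∃ λ E → LegalFrom G ∅ E × length W ≤ k + length E
  LegalFrom-length classify (φs , invs , refl) W legal =
    let E , legalE , bound = run classify φs invs W legal in E , LegalFrom-antimono G (λ ()) E legalE , bound

twinEmbedding : ∀ {V} (G : Graph V) t → Embedding G (AddTwin G t)
twinEmbedding G t = record { embed = just ; preserves = λ xy → xy ; reflects = λ xy → xy }

module _ {V : Set} (G : Graph V) (t : V) where

  -- the new twin sees every vertex its original sees
  twin-almostDominates : ∀ {T} → nothing ∉ T → AlmostDominates (AddTwin G t) (just t) T →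
                         AlmostDominates (AddTwin G t) nothing T
  twin-almostDominates nothing∉T (dominatesExcept m misses) =
    dominatesExcept m λ { {nothing} T-nothing _    → ⊥-elim (nothing∉T T-nothing)
                        ; {just v}  Tv        ¬adj → misses Tv (¬adj ∘ inj₂) }

hvEmbedding : ∀ {r h} (HG : Graph (Fin h)) → Embedding HG (ThickSpider r HG)
hvEmbedding HG = record { embed = hv ; preserves = λ ab → ab ; reflects = λ ab → ab }

module _ {r h : ℕ} where

  data InC : Pred (Maybe (Vtx r h)) 0ℓ where
    c∈C : ∀ {i} → InC (just (c i))

  data InSH : Pred (Maybe (Vtx r h)) 0ℓ where
    s∈SH  : ∀ {i} → InSH (just (s i))
    hv∈SH : ∀ {a} → InSH (just (hv a))

module _ {r h : ℕ} (HG : Graph (Fin h)) (t : Vtx r h) where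
  private
    Γ = AddTwin (ThickSpider r HG) t

    ≢-stable : {i j : Fin r} → ¬ i ≢ j → i ≡ j
    ≢-stable = decidable-stable (_ ≟ _)

  almostDominates-C : ∀ x → AlmostDominates Γ x InC
  almostDominates-C (just v) = ofOriginal v
    where
    ofOriginal : ∀ v → AlmostDominates Γ (just v) InC
    ofOriginal (s i)  = dominatesExcept (just (c i)) λ { c∈C ¬i≢j → cong (just ∘ c) (sym (≢-stable ¬i≢j)) }
    ofOriginal (c i)  = dominatesExcept (just (c i)) λ { c∈C ¬i≢j → cong (just ∘ c) (sym (≢-stable ¬i≢j)) }
    ofOriginal (hv a) = dominatesExcept nothing λ { c∈C ¬adj → ⊥-elim (¬adj tt) }
  almostDominates-C nothing = twin-almostDominates _ t (λ ()) (almostDominates-C (just t))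

  almostDominates-SH : ∀ i → AlmostDominates Γ (just (c i)) InSH
  almostDominates-SH i = dominatesExcept (just (s i))
    λ { s∈SH ¬i≢j → cong (just ∘ s) (sym (≢-stable ¬i≢j)) ; hv∈SH ¬adj → ⊥-elim (¬adj tt) }

module TwinOfC {r h : ℕ} (HG : Graph (Fin h)) (ℓ : Fin r) where
  private
    Γ = AddTwin (ThickSpider r HG) (c ℓ)
  open Regions (twinEmbedding (ThickSpider r HG) (c ℓ) ∘ᴱ hvEmbedding HG)

  regions : List (Pred (Maybe (Vtx r h)) 0ℓ)
  regions = InC ∷ ｛ nothing ｝ ∷ InSH ∷ []

  private
    C-almost : ∀ x → AlmostDominates Γ x InC
    C-almost = almostDominates-C HG (c ℓ)

    SH-almost : ∀ i → AlmostDominates Γ (just (c i)) InSH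
    SH-almost = almostDominates-SH HG (c ℓ)

    SH-almost′ : AlmostDominates Γ nothing InSH
    SH-almost′ = twin-almostDominates _ _ (λ ()) (SH-almost ℓ)

    ｛｝-almost : ∀ x → AlmostDominates Γ x ｛ nothing ｝
    ｛｝-almost x = almostDominates-｛｝ Γ x

  classify : Classifies regions
  classify {x}           {just (c _)}  _ = inj₂ (here (c∈C , C-almost x))
  classify {x}           {nothing}     _ = inj₂ (there (here (refl , ｛｝-almost x)))
  classify {just (c i)}  {just (s _)}  _ = inj₂ (there (there (here (s∈SH , SH-almost i))))
  classify {just (c i)}  {just (hv _)} _ = inj₂ (there (there (here (hv∈SH , SH-almost i))))
  classify {nothing}     {just (s _)}  _ = inj₂ (there (there (here (s∈SH , SH-almost′))))
  classify {nothing}     {just (hv _)} _ = inj₂ (there (there (here (hv∈SH , SH-almost′))))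
  classify {just (hv a)} {just (hv b)} _ = inj₁ (a , b , refl , refl)
  classify {just (s _)}  {just (s _)}  ()
  classify {just (s _)}  {just (hv _)} ()
  classify {just (hv _)} {just (s _)}  ()

  twin-dominates-C : InC ⊆ Adj Γ nothing
  twin-dominates-C (c∈C {j}) with j ≟ ℓ
  ... | yes refl = inj₁ refl
  ... | no  j≢ℓ  = inj₂ (j≢ℓ ∘ sym)

  data TwinView : Maybe (Vtx r h) → Set where
    sℓ        : TwinView (just (s ℓ))
    cℓ        : TwinView (just (c ℓ))
    c′        : TwinView nothing
    seesTwins : ∀ {x} → Adj Γ x (just (c ℓ)) → Adj Γ x nothing → TwinView x

  twinView : ∀ x → TwinView x
  twinView (just (s i)) with i ≟ ℓ
  ... | yes refl = sℓ
  ... | no  i≢ℓ  = seesTwins i≢ℓ (inj₂ (i≢ℓ ∘ sym))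
  twinView (just (c i)) with i ≟ ℓ
  ... | yes refl = cℓ
  ... | no  i≢ℓ  = seesTwins i≢ℓ (inj₂ (i≢ℓ ∘ sym))
  twinView (just (hv _)) = seesTwins tt (inj₂ tt)
  twinView nothing       = c′

  opening-seesTwin : ∀ x → Adj Γ x nothing → Budget regions (∅ ∪ Adj Γ x) 3
  opening-seesTwin x x∼c′ =
    _ , (after-almostDominates Γ (C-almost x) , after-dominates Γ x (λ { refl → x∼c′ }) , fresh , tt) , refl

  opening-twin : Budget regions (∅ ∪ Adj Γ nothing) 3
  opening-twin =
    _ , ( after-dominates Γ nothing twin-dominates-C , after-almostDominates Γ (｛｝-almost nothing)
        , fresh , tt ) , refl

  private
    Dₛ : Pred (Maybe (Vtx r h)) 0ℓ
    Dₛ = ∅ ∪ Adj Γ (just (s ℓ))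

    C-afterSℓ : Invariant InC Dₛ (allBut (just (c ℓ)))
    C-afterSℓ = after-almostDominates Γ (C-almost (just (s ℓ)))

  opening-sℓ-cℓ : Budget regions (Dₛ ∪ Adj Γ (just (c ℓ))) 2
  opening-sℓ-cℓ =
    _ , ( Invariant-mono inj₁ C-afterSℓ , after-dominates Γ (just (c ℓ)) (λ { refl → inj₁ refl })
        , after-almostDominates Γ (SH-almost ℓ) , tt ) , refl

  opening-sℓ-twin : Budget regions (Dₛ ∪ Adj Γ nothing) 2
  opening-sℓ-twin =
    _ , ( allBut⇒done Γ nothing C-afterSℓ (inj₁ refl) , after-almostDominates Γ (｛｝-almost nothing)
        , after-almostDominates Γ SH-almost′ , tt ) , refl

  opening-sℓ-seesTwins : ∀ y → Adj Γ y (just (c ℓ)) → Adj Γ y nothing → Budget regions (Dₛ ∪ Adj Γ y) 2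
  opening-sℓ-seesTwins y y∼cℓ y∼c′ =
    _ , (allBut⇒done Γ y C-afterSℓ y∼cℓ , after-dominates Γ y (λ { refl → y∼c′ }) , fresh , tt) , refl

  -- A first vertex other than s ℓ leaves at most one vertex of C ∪ {c′} undominated;
  -- after s ℓ, the second vertex dominates both twins or is one of them.
  legalBound : ∀ W → LegalFrom Γ ∅ W → ∃ λ E → LegalFrom HG ∅ E × length W ≤ 4 + length E
  legalBound []      _          = [] , tt , z≤n
  legalBound (x ∷ W) (_ , rest) with twinView x
  ... | cℓ               = map₂ (map₂ s≤s) (LegalFrom-length classify (opening-seesTwin x (inj₁ refl)) W rest)
  ... | seesTwins _ x∼c′ = map₂ (map₂ s≤s) (LegalFrom-length classify (opening-seesTwin x x∼c′) W rest)
  ... | c′               = map₂ (map₂ s≤s) (LegalFrom-length classify opening-twin W rest)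
  ... | sℓ               = afterSℓ W rest
    where
    afterSℓ : ∀ W → LegalFrom Γ Dₛ W → ∃ λ E → LegalFrom HG ∅ E × suc (length W) ≤ 4 + length E
    afterSℓ []      _                        = [] , tt , s≤s z≤n
    afterSℓ (y ∷ W) ((u , yu , u∉D) , rest) = map₂ (map₂ (s≤s ∘ s≤s)) (second (twinView y) W rest)
      where
      second : TwinView y → ∀ W → LegalFrom Γ (Dₛ ∪ Adj Γ y) W →
               ∃ λ E → LegalFrom HG ∅ E × length W ≤ 2 + length E
      second sℓ                  = ⊥-elim (u∉D (inj₂ yu))
      second cℓ                  = LegalFrom-length classify opening-sℓ-cℓ
      second c′                  = LegalFrom-length classify opening-sℓ-twin
      second (seesTwins y∼cℓ y∼c′) = LegalFrom-length classify (opening-sℓ-seesTwins y y∼cℓ y∼c′)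

  bound : AtMostLonger Γ 4 HG
  bound = AtMostLonger-fromLegalFrom legalBound

module TwinOfS {r h : ℕ} (HG : Graph (Fin h)) (ℓ : Fin r) where
  private
    Γ = AddTwin (ThickSpider r HG) (s ℓ)
  open Regions (twinEmbedding (ThickSpider r HG) (s ℓ) ∘ᴱ hvEmbedding HG)

  regions : List (Pred (Maybe (Vtx r h)) 0ℓ)
  regions = InC ∷ InSH ∷ ｛ just (s ℓ) ｝ ∷ ｛ nothing ｝ ∷ []

  private
    SH-almost : ∀ i → AlmostDominates Γ (just (c i)) InSH
    SH-almost = almostDominates-SH HG (s ℓ)

    ｛｝-almost : ∀ {m} x → AlmostDominates Γ x ｛ m ｝
    ｛｝-almost x = almostDominates-｛｝ Γ x

  classify : Classifies regions
  classify {x}           {just (c _)}  _           = inj₂ (here (c∈C , almostDominates-C HG (s ℓ) x))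
  classify {just (c i)}  {just (s _)}  _           = inj₂ (there (here (s∈SH , SH-almost i)))
  classify {just (c i)}  {just (hv _)} _           = inj₂ (there (here (hv∈SH , SH-almost i)))
  classify {nothing}     {just (s _)}  (inj₁ refl) = inj₂ (there (there (here (refl , ｛｝-almost nothing))))
  classify {x}           {nothing}     _           = inj₂ (there (there (there (here (refl , ｛｝-almost x)))))
  classify {just (hv a)} {just (hv b)} _           = inj₁ (a , b , refl , refl)
  classify {just (s _)}  {just (s _)}  ()
  classify {just (s _)}  {just (hv _)} ()
  classify {just (hv _)} {just (s _)}  ()
  classify {nothing}     {just (s _)}  (inj₂ ())
  classify {nothing}     {just (hv _)} (inj₁ ())
  classify {nothing}     {just (hv _)} (inj₂ ())

  -- a singleton region starts with its only vertex as the exception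
  start : Budget regions ∅ 6
  start = _ , (fresh , fresh , allBut (λ e _ → sym e) , allBut (λ e _ → sym e) , tt) , refl

  bound : AtMostLonger Γ 6 HG
  bound = AtMostLonger-fromLegalFrom (LegalFrom-length classify start)

spider-bound : ∀ {m h} (HG : Graph (Fin h)) → AtMostLonger (ThickSpider (suc m) HG) 4 HG
spider-bound {m} HG =
  AtMostLonger-embed {G = HG} (twinEmbedding (ThickSpider (suc m) HG) (c zero)) (TwinOfC.bound HG zero)

IsGrundyTDS-byBound : ∀ {V A} {Γ : Graph V} {G : Graph A} {seq Z} b → AtMostLonger Γ b G → IsGrundyTDS G Z →
                      Legal Γ seq → length seq ≡ b + length Z → IsGrundyTDS Γ seq
IsGrundyTDS-byBound b bound (_ , maximalZ) legal len =
  legal , λ W legalW → let E , legalE , le = bound W legalW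
                       in ≤-trans le (≤-trans (+-monoʳ-≤ b (maximalZ E legalE)) (≤-reflexive (sym len)))

IsGrundyTDS-length : ∀ {V} {Γ : Graph V} {vs n} → IsGrundyTDS Γ vs → GrundyTotalDomNum Γ n → length vs ≡ n
IsGrundyTDS-length (legal , maximal) (ws , (legalW , maximalW) , refl) =
  ≤-antisym (maximalW _ legal) (maximal ws legalW)

GrundyTotalDomNum-shift : ∀ {V W} {Γ : Graph V} {Δ : Graph W} {vs ws d} → IsGrundyTDS Γ vs → IsGrundyTDS Δ ws →
                          length ws ≡ length vs + d → ∀ n → GrundyTotalDomNum Γ n → GrundyTotalDomNum Δ (n + d)
GrundyTotalDomNum-shift {Γ = Γ} {d = d} grundy-vs grundy-ws len n γ =
  _ , grundy-ws , trans len (cong (_+ d) (IsGrundyTDS-length {Γ = Γ} grundy-vs γ))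

module Sequences {k h : ℕ} (HG : Graph (Fin h)) (Z : List (Fin h)) (grundyZ : IsGrundyTDS HG Z) where
  private
    ℓ  = fromℕ (2 + k)
    G  = ThickSpider (3 + k) HG
    GC = AddTwin G (c ℓ)
    GS = AddTwin G (s ℓ)

    legalZ : LegalFrom HG ∅ Z
    legalZ = Legal⇒LegalFrom HG Z (proj₁ grundyZ)

  tail : List (Vtx (3 + k) h)
  tail = map hv Z ++ c zero ∷ c (suc zero) ∷ []

  length-tail : length tail ≡ 2 + length Z
  length-tail = begin
    length tail           ≡⟨ length-++ (map hv Z) ⟩
    length (map hv Z) + 2 ≡⟨ cong (_+ 2) (length-map hv Z) ⟩
    length Z + 2          ≡⟨ +-comm (length Z) 2 ⟩
    2 + length Z          ∎
    where open ≡-Reasoning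

  -- zero and suc zero stand for the paper's indices 1 and 2: c₁, c₂ footprint s₂, s₁,
  -- which H never dominates
  tail-legal : ∀ {D} → (∀ {a} → hv a ∉ D) → s zero ∉ D → s (suc zero) ∉ D → LegalFrom G D tail
  tail-legal hv∉D s₁∉D s₂∉D =
    LegalFrom-++ G (map hv Z) (LegalFrom-embed (hvEmbedding HG) hv∉D Z legalZ)
      ( (s (suc zero) , (λ ()) , ∉-∪N* G (map hv Z) H-misses-S s₂∉D)
      , (s zero , (λ ()) , [ ∉-∪N* G (map hv Z) H-misses-S s₁∉D , (λ 1≢1 → 1≢1 refl) ])
      , tt )
    where
    H-misses-S : ∀ {j} → All (λ x → ¬ Adj G x (s j)) (map hv Z)
    H-misses-S = All.map⁺ (All.universal (λ _ ()) Z)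

  seq₁ : List (Vtx (3 + k) h)
  seq₁ = s zero ∷ s (suc zero) ∷ tail

  length-seq₁ : length seq₁ ≡ 4 + length Z
  length-seq₁ = cong (2 +_) length-tail

  seq₁-legal : Legal G seq₁
  seq₁-legal = LegalFrom⇒Legal G seq₁
    ( (c (suc zero) , (λ ()) , (λ ()))
    , (c zero , (λ ()) , [ (λ ()) , (λ 1≢1 → 1≢1 refl) ])
    , tail-legal seenByS seenByS seenByS )
    where
    seenByS = λ { (inj₁ (inj₁ ())) ; (inj₁ (inj₂ ())) ; (inj₂ ()) }

  length-seq₁′ : length (map just seq₁) ≡ 4 + length Z
  length-seq₁′ = trans (length-map just seq₁) length-seq₁

  prefix : List (Maybe (Vtx (3 + k) h))
  prefix = just (s zero) ∷ just (s (suc zero)) ∷ just (s ℓ) ∷ nothing ∷ []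

  seq₂ : List (Maybe (Vtx (3 + k) h))
  seq₂ = prefix ++ map just tail

  length-seq₂ : length seq₂ ≡ 6 + length Z
  length-seq₂ = cong (4 +_) (trans (length-map just tail) length-tail)

  length-seq₂≡length-seq₁+2 : length seq₂ ≡ length seq₁ + 2
  length-seq₂≡length-seq₁+2 = begin
    length seq₂        ≡⟨ length-seq₂ ⟩
    2 + (4 + length Z) ≡⟨ +-comm 2 _ ⟩
    4 + length Z + 2   ≡⟨ cong (_+ 2) (sym length-seq₁) ⟩
    length seq₁ + 2    ∎
    where open ≡-Reasoning

  -- after s₁ and s₂, the vertex s ℓ and its twin footprint each other
  prefix-legal : LegalFrom GS ∅ prefix
  prefix-legal =
    ( (just (c (suc zero)) , (λ ()) , (λ ()))
    , (just (c zero) , (λ ()) , [ (λ ()) , (λ 1≢1 → 1≢1 refl) ])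
    , (nothing , inj₁ refl , λ { (inj₁ (inj₁ ())) ; (inj₁ (inj₂ (inj₁ ()))) ; (inj₁ (inj₂ (inj₂ ())))
                               ; (inj₂ (inj₁ ())) ; (inj₂ (inj₂ ())) })
    , (just (s ℓ) , inj₁ refl , λ { (inj₁ (inj₁ (inj₁ ()))) ; (inj₁ (inj₁ (inj₂ ()))) ; (inj₁ (inj₂ ()))
                                  ; (inj₂ ()) })
    , tt )

  seq₂-legal : Legal GS seq₂
  seq₂-legal = LegalFrom⇒Legal GS seq₂ (LegalFrom-++ GS prefix prefix-legal
    (LegalFrom-embed (twinEmbedding G (s ℓ)) (λ d → d) tail (tail-legal
      (λ { (inj₁ (inj₁ (inj₁ (inj₁ ())))) ; (inj₁ (inj₁ (inj₁ (inj₂ ())))) ; (inj₁ (inj₁ (inj₂ ())))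
         ; (inj₁ (inj₂ ())) ; (inj₂ (inj₁ ())) ; (inj₂ (inj₂ ())) })
      (λ { (inj₁ (inj₁ (inj₁ (inj₁ ())))) ; (inj₁ (inj₁ (inj₁ (inj₂ ())))) ; (inj₁ (inj₁ (inj₂ ())))
         ; (inj₁ (inj₂ ())) ; (inj₂ (inj₁ ())) ; (inj₂ (inj₂ ())) })
      (λ { (inj₁ (inj₁ (inj₁ (inj₁ ())))) ; (inj₁ (inj₁ (inj₁ (inj₂ ())))) ; (inj₁ (inj₁ (inj₂ ())))
         ; (inj₁ (inj₂ ())) ; (inj₂ (inj₁ ())) ; (inj₂ (inj₂ ())) }))))

  G-grundy : IsGrundyTDS G seq₁
  G-grundy = IsGrundyTDS-byBound {Γ = G} {G = HG} 4 (spider-bound HG) grundyZ seq₁-legal length-seq₁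

  GC-grundy : IsGrundyTDS GC (map just seq₁)
  GC-grundy = IsGrundyTDS-byBound {Γ = GC} {G = HG} 4 (TwinOfC.bound HG ℓ) grundyZ
                (Legal-embed (twinEmbedding G (c ℓ)) seq₁-legal) length-seq₁′

  GS-grundy : IsGrundyTDS GS seq₂
  GS-grundy = IsGrundyTDS-byBound {Γ = GS} {G = HG} 6 (TwinOfS.bound HG ℓ) grundyZ seq₂-legal length-seq₂

  GS-number : ∀ n → GrundyTotalDomNum G n → GrundyTotalDomNum GS (n + 2)
  GS-number = GrundyTotalDomNum-shift {Γ = G} {Δ = GS} G-grundy GS-grundy length-seq₂≡length-seq₁+2

proposition5p4 : (k h : ℕ) (HG : Graph (Fin h)) (Z : List (Fin h)) →
    IsGrundyTDS HG Z →
    let G  = ThickSpider (3 + k) HG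
        GC = SpiderCK2 (2 + k) HG
        GS = SpiderSK2 (2 + k) HG
        seq1 = s zero ∷ s (suc zero) ∷ map hv Z ++ c zero ∷ c (suc zero) ∷ []
        seq2 = just (s zero) ∷ just (s (suc zero)) ∷ just (s (fromℕ (2 + k))) ∷ nothing
                 ∷ map just (map hv Z ++ c zero ∷ c (suc zero) ∷ [])
    in (IsGrundyTDS G seq1 × IsGrundyTDS GC (map just seq1)
         × GrundyTotalDomNum G (4 + length Z) × GrundyTotalDomNum GC (4 + length Z))
       × (IsGrundyTDS GS seq2
         × (∀ n → GrundyTotalDomNum G n → GrundyTotalDomNum GS (n + 2))
         × GrundyTotalDomNum GS (6 + length Z))
proposition5p4 k h HG Z grundyZ =
    ( G-grundy , GC-grundy
    , (seq₁ , G-grundy , length-seq₁) , (map just seq₁ , GC-grundy , length-seq₁′) )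
  , ( GS-grundy
    , GS-number
    , (seq₂ , GS-grundy , length-seq₂) )
  where open Sequences {k} HG Z grundyZ
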